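{- Let $\tau$ be a primary irreducible type of width $k$ and let $X,Y\subseteq\mathbb{Q}$ be finite sets with $\tau(X,Y)=\tau$. Write $X=\{x_1<\dots<x_k\}$ and $Y=\{y_1<\dots<y_k\}$. Then (a) $x_i<y_i$ for all $i\in[k]$, and (b) $x_{i+1}\le y_i$ for all $i\in[k-1]$.
   Context: For finite sets $X,Y\subseteq\mathbb{Q}$ with $X\cup Y=\{z_1<\dots<z_\ell\}$, the order type $\tau(X,Y)$ is the sequence $(\tau_1,\dots,\tau_\ell)$ with $\tau_i=1$ if $z_i\in X\setminus Y$, $2$ if $z_i\in Y\setminus X$, $3$ if $z_i\in X\cap Y$. A type of width $k$ is the order type of a pair $(X,Y)$ of finite subsets of $\mathbb{Q}$ with $|X|=|Y|=k$; the empty sequence is also a type. A nonempty type is irreducible if it cannot be written as the concatenation of two nonempty types; an irreducible type is primary if its first entry is $1$. -}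

module Defs where

open import Data.Nat using (ℕ; suc)
open import Data.Fin using (Fin; toℕ)
open import Data.Rational using (ℚ; _<_; _≤_)
open import Data.Rational.Properties using (<-cmp)
open import Data.List using (List; []; _∷_; _++_)
open import Data.Vec using (Vec; lookup; toList)
open import Data.Product using (Σ; ∃; _×_)
open import Relation.Binary.Definitions using (tri<; tri≈; tri>)
open import Relation.Binary.PropositionalEquality using (_≡_; _≢_)
open import Relation.Nullary using (¬_)

-- Entries of an order type: 1 = only in X, 2 = only in Y, 3 = in both.
data Label : Set where
  one two three : Label

-- A finite set {z₁ < … < zₖ} ⊆ ℚ is represented by the strictly increasing
-- vector (z₁, …, zₖ).
StrictlyIncreasing : ∀ {k} → Vec ℚ k → Set
StrictlyIncreasing {k} v = ∀ (i j : Fin k) → toℕ i Data.Nat.< toℕ j → lookup v i < lookup v j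
  where import Data.Nat

orderTypeL : List ℚ → List ℚ → List Label
orderTypeL [] ys = Data.List.map (λ _ → two) ys
orderTypeL (x ∷ xs) [] = one ∷ orderTypeL xs []
orderTypeL (x ∷ xs) (y ∷ ys) = step x xs y ys (orderTypeL xs (y ∷ ys))
  (orderTypeL xs ys) (orderTypeL (x ∷ xs) ys)
  where
  step : ℚ → List ℚ → ℚ → List ℚ → List Label → List Label → List Label → List Label
  step x _ y _ lt eq gt with <-cmp x y
  ... | tri< _ _ _ = one ∷ lt
  ... | tri≈ _ _ _ = three ∷ eq
  ... | tri> _ _ _ = two ∷ gt

orderType : ∀ {k l} → Vec ℚ k → Vec ℚ l → List Label
orderType xs ys = orderTypeL (toList xs) (toList ys)

IsTypeOfWidth : ℕ → List Label → Set
IsTypeOfWidth k τ = Σ (Vec ℚ k) λ xs → Σ (Vec ℚ k) λ ys →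
  StrictlyIncreasing xs × StrictlyIncreasing ys × orderType xs ys ≡ τ

IsType : List Label → Set
IsType τ = ∃ λ k → IsTypeOfWidth k τ

Irreducible : List Label → Set
Irreducible τ = τ ≢ [] ×
  (∀ (α β : List Label) → α ≢ [] → β ≢ [] → IsType α → IsType β → ¬ (τ ≡ α ++ β))

Primary : List Label → Set
Primary τ = Σ (List Label) λ τ' → τ ≡ one ∷ τ'

-- If y_i < x_{i+1}, then every element of X and Y up to position i is at most y_i and every later
-- element exceeds y_i, so the order type splits at that point into the types of the two halves,
-- contradicting irreducibility.  Hence x_{i+1} ≤ y_i < y_{i+1}, and (a) propagates from x_1 < y_1,
-- which holds because the type is primary.
module Submission where

open import Defs
open import Data.Nat using (ℕ; suc; zero; s≤s; z≤n; _+_)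
open import Data.Nat.Properties using (suc-injective)
open import Data.Fin using (Fin; toℕ; zero; suc)
open import Data.Rational using (ℚ; _<_; _≤_)
open import Data.Rational.Properties using (<-cmp; <-trans; ≤-<-trans; ≤-trans; <⇒≤; ≮⇒≥; ≤-refl)
open import Data.List using (List; []; _∷_; _++_; [_]; length; map)
open import Data.List.Properties using (++-assoc; ++-conicalʳ; length-++; map-++)
open import Data.List.Relation.Unary.All as All using (All; []; _∷_)
open import Data.List.Relation.Unary.All.Properties using (++⁺; ++⁻ˡ)
open import Data.List.Relation.Unary.AllPairs using (AllPairs; []; _∷_)
open import Data.Vec using (Vec; lookup; toList; fromList; head; []; _∷_)
open import Data.Vec.Properties using (length-toList; toList∘fromList)
import Data.Vec.Relation.Unary.All.Properties as VecAll
open import Data.Product using (_×_; _,_; ∃; proj₂)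
open import Function using (case_of_)
open import Data.Empty using (⊥; ⊥-elim)
open import Relation.Binary.Core using (Rel)
open import Relation.Binary.Definitions using (tri<; tri≈; tri>)
open import Relation.Binary.PropositionalEquality using (_≡_; _≢_; refl; sym; trans; cong; cong₂; subst)

Sorted : List ℚ → Set
Sorted = AllPairs _<_

AllPairs-++⁻ : ∀ {a ℓ} {A : Set a} {R : Rel A ℓ} (xs : List A) {ys : List A} →
  AllPairs R (xs ++ ys) → AllPairs R xs × AllPairs R ys
AllPairs-++⁻ []       rs         = [] , rs
AllPairs-++⁻ (x ∷ xs) (rx ∷ rs) with AllPairs-++⁻ xs rs
... | rxs , rys = ++⁻ˡ xs rx ∷ rxs , rys

strictlyIncreasing⇒sorted : ∀ {k} {v : Vec ℚ k} → StrictlyIncreasing v → Sorted (toList v)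
strictlyIncreasing⇒sorted {v = []}    _  = []
strictlyIncreasing⇒sorted {v = x ∷ v} v↑ =
  VecAll.toList⁺ (VecAll.lookup⁻ λ j → v↑ zero (suc j) (s≤s z≤n)) ∷
  strictlyIncreasing⇒sorted (λ i j i<j → v↑ (suc i) (suc j) (s≤s i<j))

sorted⇒strictlyIncreasing : ∀ {k} {v : Vec ℚ k} → Sorted (toList v) → StrictlyIncreasing v
sorted⇒strictlyIncreasing {v = _ ∷ _} (x<v ∷ _) zero    (suc j) _         = VecAll.lookup⁺ (VecAll.toList⁻ x<v) j
sorted⇒strictlyIncreasing {v = _ ∷ _} (_ ∷ v↑)  (suc i) (suc j) (s≤s i<j) = sorted⇒strictlyIncreasing v↑ i j i<j

sorted⇒vector : ∀ {k} (A : List ℚ) → length A ≡ k → Sorted A →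
  ∃ λ (v : Vec ℚ k) → StrictlyIncreasing v × toList v ≡ A
sorted⇒vector A refl A↑ =
  fromList A , sorted⇒strictlyIncreasing (subst Sorted (sym (toList∘fromList A)) A↑) , toList∘fromList A

sorted⇒isType : ∀ {A C} → Sorted A → Sorted C → length A ≡ length C → IsType (orderTypeL A C)
sorted⇒isType {A} {C} A↑ C↑ |A|≡|C| with sorted⇒vector A refl A↑ | sorted⇒vector C (sym |A|≡|C|) C↑
... | u , u↑ , u≡A | w , w↑ , w≡C = length A , u , w , u↑ , w↑ , cong₂ orderTypeL u≡A w≡C

orderTypeL-x<ys : ∀ {x} xs {ys} → All (x <_) ys → orderTypeL (x ∷ xs) ys ≡ one ∷ orderTypeL xs ys
orderTypeL-x<ys     xs []                = refl
orderTypeL-x<ys {x} xs (_∷_ {y} x<y _) with <-cmp x y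
... | tri< _ _ _   = refl
... | tri≈ x≮y _ _ = ⊥-elim (x≮y x<y)
... | tri> x≮y _ _ = ⊥-elim (x≮y x<y)

orderTypeL-ys<x : ∀ {x} xs {ys} zs → All (_< x) ys →
  orderTypeL (x ∷ xs) (ys ++ zs) ≡ map (λ _ → two) ys ++ orderTypeL (x ∷ xs) zs
orderTypeL-ys<x     xs zs []                = refl
orderTypeL-ys<x {x} xs zs (_∷_ {y} y<x ys<x) with <-cmp x y
... | tri< _ _ y≮x = ⊥-elim (y≮x y<x)
... | tri≈ _ _ y≮x = ⊥-elim (y≮x y<x)
... | tri> _ _ _   = cong (two ∷_) (orderTypeL-ys<x xs zs ys<x)

primary⇒head< : ∀ {x y} xs ys → Primary (orderTypeL (x ∷ xs) (y ∷ ys)) → x < y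
primary⇒head< {x} {y} _ _ (_ , e) with <-cmp x y | e
... | tri< x<y _ _ | _ = x<y

orderTypeL-≢[] : ∀ {A C} → A ≢ [] → orderTypeL A C ≢ []
orderTypeL-≢[] {[]}    {C}     A≢[] = ⊥-elim (A≢[] refl)
orderTypeL-≢[] {a ∷ A} {[]}    _    ()
orderTypeL-≢[] {a ∷ A} {c ∷ C} _    with <-cmp a c
... | tri< _ _ _ = λ ()
... | tri≈ _ _ _ = λ ()
... | tri> _ _ _ = λ ()

orderTypeL-++ : ∀ t A B C D → All (_≤ t) A → All (_≤ t) C → All (t <_) B → All (t <_) D →
  orderTypeL (A ++ B) (C ++ D) ≡ orderTypeL A C ++ orderTypeL B D
orderTypeL-++ t []      []      C D _           _   _         _   = map-++ _ C D
orderTypeL-++ t []      (b ∷ B) C D _           C≤t (t<b ∷ _) _   =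
  orderTypeL-ys<x B D (All.map (λ c≤t → ≤-<-trans c≤t t<b) C≤t)
orderTypeL-++ t (a ∷ A) B       C D (a≤t ∷ A≤t) C≤t B>t       D>t = go C C≤t
  where
  go : ∀ C → All (_≤ t) C → orderTypeL (a ∷ A ++ B) (C ++ D) ≡ orderTypeL (a ∷ A) C ++ orderTypeL B D
  go []      _           =
    trans (orderTypeL-x<ys (A ++ B) (All.map (≤-<-trans a≤t) D>t))
          (cong (one ∷_) (orderTypeL-++ t A B [] D A≤t [] B>t D>t))
  go (c ∷ C) (c≤t ∷ C≤t) with <-cmp a c
  ... | tri< _ _ _ = cong (one ∷_)   (orderTypeL-++ t A B (c ∷ C) D A≤t (c≤t ∷ C≤t) B>t D>t)
  ... | tri≈ _ _ _ = cong (three ∷_) (orderTypeL-++ t A B C D A≤t C≤t B>t D>t)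
  ... | tri> _ _ _ = cong (two ∷_)   (go C C≤t)

Interlaced : ∀ {k} → Vec ℚ k → Vec ℚ k → Set
Interlaced xs ys = (∀ i → lookup xs i < lookup ys i) ×
                   (∀ i j → toℕ j ≡ suc (toℕ i) → lookup xs j ≤ lookup ys i)

interlaced-[_] : ∀ {x y} → x < y → Interlaced (x ∷ []) (y ∷ [])
interlaced-[ x<y ] = (λ { zero → x<y }) , λ { zero zero () }

interlaced-∷ : ∀ {k x x′ y y′} {xs ys : Vec ℚ k} → x < y → x′ ≤ y →
  Interlaced (x′ ∷ xs) (y′ ∷ ys) → Interlaced (x ∷ x′ ∷ xs) (y ∷ y′ ∷ ys)
interlaced-∷ {x′ = x′} {y = y} {xs = xs} {ys} x<y x′≤y (below , before) = below′ , before′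
  where
  below′ : ∀ i → lookup (_ ∷ x′ ∷ xs) i < lookup (y ∷ _ ∷ ys) i
  below′ zero    = x<y
  below′ (suc i) = below i
  before′ : ∀ i j → toℕ j ≡ suc (toℕ i) → lookup (_ ∷ x′ ∷ xs) j ≤ lookup (y ∷ _ ∷ ys) i
  before′ zero    (suc zero)    _ = x′≤y
  before′ (suc i) (suc j)       e = before i j (suc-injective e)
  before′ zero    zero          ()
  before′ zero    (suc (suc j)) ()
  before′ (suc i) zero          ()

module _ {X Y : List ℚ} (irr : Irreducible (orderTypeL X Y)) (X↑ : Sorted X) (Y↑ : Sorted Y) where

  no-cut : ∀ {A B C D} t → X ≡ A ++ B → Y ≡ C ++ D → length A ≡ length C → length B ≡ length D →
    A ≢ [] → B ≢ [] → All (_≤ t) A → All (_≤ t) C → All (t <_) B → All (t <_) D → ⊥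
  no-cut {A} {B} {C} {D} t refl refl |A|≡|C| |B|≡|D| A≢[] B≢[] A≤t C≤t B>t D>t
    with AllPairs-++⁻ A X↑ | AllPairs-++⁻ C Y↑
  ... | A↑ , B↑ | C↑ , D↑ =
    proj₂ irr (orderTypeL A C) (orderTypeL B D) (orderTypeL-≢[] A≢[]) (orderTypeL-≢[] B≢[])
      (sorted⇒isType A↑ C↑ |A|≡|C|) (sorted⇒isType B↑ D↑ |B|≡|D|)
      (orderTypeL-++ t A B C D A≤t C≤t B>t D>t)

  interlaced-suffix : ∀ {n} P Q (xs ys : Vec ℚ (suc n)) → X ≡ P ++ toList xs → Y ≡ Q ++ toList ys →
    length P ≡ length Q → All (_≤ head ys) P → All (_≤ head ys) Q →
    Sorted (toList xs) → Sorted (toList ys) → head xs < head ys → Interlaced xs ys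
  interlaced-suffix P Q (x ∷ []) (y ∷ []) _ _ _ _ _ _ _ x<y = interlaced-[ x<y ]
  interlaced-suffix P Q (x ∷ x′ ∷ xs) (y ∷ y′ ∷ ys) X≡ Y≡ |P|≡|Q| P≤y Q≤y
                    (_ ∷ x′∷xs↑@(x′<xs ∷ _)) (y<y′∷ys@(y<y′ ∷ _) ∷ y′∷ys↑) x<y =
    interlaced-∷ x<y x′≤y
      (interlaced-suffix (P ++ [ x ]) (Q ++ [ y ]) (x′ ∷ xs) (y′ ∷ ys) X≡′ Y≡′ |P′|≡|Q′|
        (raise P′≤y) (raise Q′≤y) x′∷xs↑ y′∷ys↑ (≤-<-trans x′≤y y<y′))
    where
    raise : ∀ {Z} → All (_≤ y) Z → All (_≤ y′) Z
    raise = All.map (λ z≤y → ≤-trans z≤y (<⇒≤ y<y′))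
    X≡′ : X ≡ (P ++ [ x ]) ++ toList (x′ ∷ xs)
    X≡′ = trans X≡ (sym (++-assoc P [ x ] _))
    Y≡′ : Y ≡ (Q ++ [ y ]) ++ toList (y′ ∷ ys)
    Y≡′ = trans Y≡ (sym (++-assoc Q [ y ] _))
    |P′|≡|Q′| : length (P ++ [ x ]) ≡ length (Q ++ [ y ])
    |P′|≡|Q′| = trans (length-++ P) (trans (cong (_+ 1) |P|≡|Q|) (sym (length-++ Q)))
    P′≤y : All (_≤ y) (P ++ [ x ])
    P′≤y = ++⁺ P≤y (<⇒≤ x<y ∷ [])
    Q′≤y : All (_≤ y) (Q ++ [ y ])
    Q′≤y = ++⁺ Q≤y (≤-refl ∷ [])
    x′≤y : x′ ≤ y
    x′≤y = ≮⇒≥ λ y<x′ →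
      no-cut y X≡′ Y≡′ |P′|≡|Q′| (trans (length-toList (x′ ∷ xs)) (sym (length-toList (y′ ∷ ys))))
        (λ e → case ++-conicalʳ P [ x ] e of λ ()) (λ ())
        P′≤y Q′≤y (y<x′ ∷ All.map (<-trans y<x′) x′<xs) y<y′∷ys

lemma2p2 : (k : ℕ) (τ : List Label) → IsTypeOfWidth k τ → Irreducible τ → Primary τ →
    (xs ys : Vec ℚ k) → StrictlyIncreasing xs → StrictlyIncreasing ys →
    orderType xs ys ≡ τ →
    (∀ (i : Fin k) → lookup xs i < lookup ys i) ×
    (∀ (i j : Fin k) → toℕ j ≡ suc (toℕ i) → lookup xs j ≤ lookup ys i)
lemma2p2 zero    _ _ _   _       []       []       _   _   _    = (λ ()) , (λ ())
lemma2p2 (suc k) _ _ irr primary (x ∷ xs) (y ∷ ys) xs↑ ys↑ refl =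
  interlaced-suffix irr X↑ Y↑ [] [] (x ∷ xs) (y ∷ ys) refl refl refl [] [] X↑ Y↑
    (primary⇒head< (toList xs) (toList ys) primary)
  where
  X↑ : Sorted (x ∷ toList xs)
  X↑ = strictlyIncreasing⇒sorted xs↑
  Y↑ : Sorted (y ∷ toList ys)
  Y↑ = strictlyIncreasing⇒sorted ys↑
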